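{- For every integer $k\ge 1$, $f_d(Q_{4k})\ge 4k+4$.
   Context: $Q_n$ is the $n$-dimensional hypercube: vertices are binary strings of length $n$, adjacent iff they differ in exactly one position. The \emph{Explorer–Director game} on a finite connected graph $G$ with starting vertex $v$: a token starts on $v$; in each round, with the token on $u$, the Explorer names a distance $d$ such that some vertex is at distance $d$ from $u$, and the Director moves the token to any vertex at distance exactly $d$ from $u$. Visited vertices are those the token has ever occupied (including $v$). The Explorer maximizes and the Director minimizes the number of visited vertices; the game ends when the Director can keep the token on visited vertices indefinitely; $f_d(G,v)$ is the final number of visited vertices under optimal play. Since $Q_n$ is vertex-transitive, $f_d(Q_n,v)$ does not depend on $v$ and is written $f_d(Q_n)$. -}

module Defs where

open import Data.Nat using (ℕ; zero; suc; _+_; _≤_)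
open import Data.Bool using (Bool; true; false; if_then_else_)
open import Data.Vec using (Vec; []; _∷_)
open import Data.List using (List; []; _∷_; length)
open import Data.List.Membership.Propositional using (_∈_)
open import Data.List.Relation.Unary.All using (All)
open import Data.List.Relation.Unary.Unique.Propositional using (Unique)
open import Data.Product using (Σ; ∃; _×_)
open import Relation.Binary.PropositionalEquality using (_≡_; _≢_)

Vertex : ℕ → Set
Vertex n = Vec Bool n

-- Distance in Q_n: the Hamming distance (number of differing positions),
-- which is the shortest-path distance of Q_n.
dist : ∀ {n} → Vertex n → Vertex n → ℕ
dist []       []       = 0
dist (x ∷ xs) (y ∷ ys) = (if (x Data.Bool.xor y) then 1 else 0) + dist xs ys

Adjacent : ∀ {n} → Vertex n → Vertex n → Set
Adjacent u w = dist u w ≡ 1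

AtLeastVisited : ∀ {n} → ℕ → List (Vertex n) → Set
AtLeastVisited {n} N S =
  Σ (List (Vertex n)) λ L → Unique L × (N ≤ length L) × All (λ x → x ∈ S) L

-- ExplorerForces N u S : with the token on u and visited set S, the Explorer
-- has a strategy guaranteeing that (after finitely many rounds, whatever the
-- Director does) at least N distinct vertices have been visited.
data ExplorerForces {n : ℕ} (N : ℕ) : Vertex n → List (Vertex n) → Set where
  done  : ∀ {u S} → AtLeastVisited N S → ExplorerForces N u S
  round : ∀ {u S} (d : ℕ) →
          (∃ λ w → dist u w ≡ d) →
          (∀ w → dist u w ≡ d → ExplorerForces N w (w ∷ S)) →
          ExplorerForces N u S

fd-Q-≥ : (n : ℕ) → Vertex n → ℕ → Set
fd-Q-≥ n v N = ExplorerForces N v (v ∷ [])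

-- The Explorer keeps the visited set closed under antipodes: after naming a
-- distance d and seeing the token land on w, she names n, which forces the
-- token onto the antipode of w.  A pair {w, antipode w} is certainly new when
-- no visited vertex lies at distance d from the token, and since the distances
-- from u to an antipodal pair are a and n − a, each visited pair blocks at
-- most one of the K + 1 even distances 0, 2, …, 2K ≤ n/2.  Even distances keep
-- the token in its parity class while vertices of the other class are never at
-- even distance, so by pigeonhole the Explorer collects K + 1 pairs in her
-- starting parity class, switches class with distance 1, and collects K + 1
-- more pairs there: 4K + 4 vertices in all.
module Submission where

open import Defs
open import Data.Bool using (Bool; true; false; not; _xor_; if_then_else_)
open import Data.List using (List; []; _∷_; length; _++_; map; filter; upTo)
open import Data.List.Membership.Propositional using (_∈_; _∉_)
open import Data.List.Membership.Propositional.Properties using (∈-map⁺; ∈-map⁻; ∈-filter⁺; ∈-upTo⁻)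
open import Data.List.Properties using (length-map; length-++; ++-identityʳ; length-upTo; filter-notAll)
open import Data.List.Relation.Unary.All as All using (All; []; _∷_)
open import Data.List.Relation.Unary.All.Properties using (¬Any⇒All¬; ++⁺)
open import Data.List.Relation.Unary.Any as Any using (here; there)
open import Data.List.Relation.Unary.AllPairs using ([]; _∷_)
open import Data.List.Relation.Unary.Unique.Propositional using (Unique)
import Data.List.Relation.Unary.Unique.Propositional.Properties as Unique
open import Data.Nat using (ℕ; zero; suc; _+_; _*_; _≤_; _<_; _⊓_; z≤n; s≤s; s≤s⁻¹; parity)
open import Data.Nat.Properties
open import Data.Nat.Tactic.RingSolver using (solve-∀)
open import Data.Parity using (Parity; 0ℙ; 1ℙ)
import Data.Parity as ℙ
open import Data.Parity.Properties using (p+p≡0ℙ; +-homo-+; *-homo-*)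
import Data.Parity.Properties as ℙ
open import Algebra.Properties.CommutativeSemigroup ℙ.+-commutativeSemigroup using (interchange)
open import Data.Product using (∃; _×_; _,_)
open import Data.Sum using (_⊎_; inj₁; inj₂)
open import Data.Vec using ([]; _∷_)
import Data.Vec as Vec
open import Function using (_∘_)
open import Data.Empty using (⊥)
open import Relation.Binary.Definitions using (DecidableEquality)
open import Relation.Nullary using (yes; no; ¬?; contradiction)
open import Relation.Binary.PropositionalEquality

antipode : ∀ {n} → Vertex n → Vertex n
antipode = Vec.map not

antipode-involutive : ∀ {n} (x : Vertex n) → antipode (antipode x) ≡ x
antipode-involutive []          = refl
antipode-involutive (false ∷ x) = cong (false ∷_) (antipode-involutive x)
antipode-involutive (true ∷ x)  = cong (true ∷_) (antipode-involutive x)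

dist-self : ∀ {n} (u : Vertex n) → dist u u ≡ 0
dist-self []          = refl
dist-self (false ∷ u) = dist-self u
dist-self (true ∷ u)  = dist-self u

dist-≤ : ∀ {n} (u w : Vertex n) → dist u w ≤ n
dist-≤ []          []          = z≤n
dist-≤ (false ∷ u) (false ∷ w) = m≤n⇒m≤1+n (dist-≤ u w)
dist-≤ (false ∷ u) (true ∷ w)  = s≤s (dist-≤ u w)
dist-≤ (true ∷ u)  (false ∷ w) = s≤s (dist-≤ u w)
dist-≤ (true ∷ u)  (true ∷ w)  = m≤n⇒m≤1+n (dist-≤ u w)

dist+dist-antipode : ∀ {n} (u w : Vertex n) → dist u w + dist u (antipode w) ≡ n
dist+dist-antipode []          []          = refl
dist+dist-antipode (false ∷ u) (false ∷ w) =
  trans (+-suc (dist u w) _) (cong suc (dist+dist-antipode u w))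
dist+dist-antipode (false ∷ u) (true ∷ w)  = cong suc (dist+dist-antipode u w)
dist+dist-antipode (true ∷ u)  (false ∷ w) = cong suc (dist+dist-antipode u w)
dist+dist-antipode (true ∷ u)  (true ∷ w)  =
  trans (+-suc (dist u w) _) (cong suc (dist+dist-antipode u w))

dist≡n⇒antipode : ∀ {n} (u w : Vertex n) → dist u w ≡ n → w ≡ antipode u
dist≡n⇒antipode []          []          _ = refl
dist≡n⇒antipode (false ∷ u) (false ∷ w) e = contradiction e (<⇒≢ (s≤s (dist-≤ u w)))
dist≡n⇒antipode (false ∷ u) (true ∷ w)  e = cong (true ∷_) (dist≡n⇒antipode u w (suc-injective e))
dist≡n⇒antipode (true ∷ u)  (false ∷ w) e = cong (false ∷_) (dist≡n⇒antipode u w (suc-injective e))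
dist≡n⇒antipode (true ∷ u)  (true ∷ w)  e = contradiction e (<⇒≢ (s≤s (dist-≤ u w)))

dist-antipode : ∀ {n} (u : Vertex n) → dist u (antipode u) ≡ n
dist-antipode u = trans (cong (_+ dist u (antipode u)) (sym (dist-self u))) (dist+dist-antipode u u)

antipode≢ : ∀ {n} → 0 < n → (u : Vertex n) → antipode u ≢ u
antipode≢ n>0 u eq = <⇒≢ n>0 (trans (sym (dist-self u)) (trans (cong (dist u) (sym eq)) (dist-antipode u)))

pairDist : ∀ {n} → Vertex n → Vertex n → ℕ
pairDist u y = dist u y ⊓ dist u (antipode y)

pairDist≡ : ∀ {n} (u y : Vertex n) {c} → c + c ≤ n →
            dist u y ≡ c ⊎ dist u (antipode y) ≡ c → pairDist u y ≡ c
pairDist≡ u y c+c≤n (inj₁ refl) =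
  m≤n⇒m⊓n≡m (+-cancelˡ-≤ _ _ _ (≤-trans c+c≤n (≤-reflexive (sym (dist+dist-antipode u y)))))
pairDist≡ u y c+c≤n (inj₂ refl) =
  m≥n⇒m⊓n≡n (+-cancelʳ-≤ _ _ _ (≤-trans c+c≤n (≤-reflexive (sym (dist+dist-antipode u y)))))

dist-surjective : ∀ {n} (u : Vertex n) {d} → d ≤ n → ∃ λ w → dist u w ≡ d
dist-surjective u           {zero}  _         = u , dist-self u
dist-surjective (false ∷ u) {suc d} (s≤s d≤n) with w , e ← dist-surjective u d≤n = true ∷ w , cong suc e
dist-surjective (true ∷ u)  {suc d} (s≤s d≤n) with w , e ← dist-surjective u d≤n = false ∷ w , cong suc e

bitParity : Bool → Parity
bitParity false = 0ℙ
bitParity true  = 1ℙ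

parityᵛ : ∀ {n} → Vertex n → Parity
parityᵛ []      = 0ℙ
parityᵛ (b ∷ x) = bitParity b ℙ.+ parityᵛ x

parity-xor : ∀ a b → parity (if a xor b then 1 else 0) ≡ bitParity a ℙ.+ bitParity b
parity-xor false false = refl
parity-xor false true  = refl
parity-xor true  false = refl
parity-xor true  true  = refl

dist-parity : ∀ {n} (u w : Vertex n) → parity (dist u w) ≡ parityᵛ u ℙ.+ parityᵛ w
dist-parity []      []      = refl
dist-parity (a ∷ u) (b ∷ w) = begin
  parity ((if a xor b then 1 else 0) + dist u w)
    ≡⟨ +-homo-+ (if a xor b then 1 else 0) (dist u w) ⟩
  parity (if a xor b then 1 else 0) ℙ.+ parity (dist u w)
    ≡⟨ cong₂ ℙ._+_ (parity-xor a b) (dist-parity u w) ⟩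
  (bitParity a ℙ.+ bitParity b) ℙ.+ (parityᵛ u ℙ.+ parityᵛ w)
    ≡⟨ interchange (bitParity a) (bitParity b) (parityᵛ u) (parityᵛ w) ⟩
  (bitParity a ℙ.+ parityᵛ u) ℙ.+ (bitParity b ℙ.+ parityᵛ w) ∎
  where open ≡-Reasoning

even-dist⇒≡parityᵛ : ∀ {n} (u w : Vertex n) → parity (dist u w) ≡ 0ℙ → parityᵛ u ≡ parityᵛ w
even-dist⇒≡parityᵛ u w even =
  ℙ.+-cancelʳ-≡ (parityᵛ w) (parityᵛ u) (parityᵛ w)
    (trans (sym (dist-parity u w)) (trans even (sym (p+p≡0ℙ (parityᵛ w)))))

≡parityᵛ⇒even-dist : ∀ {n} (u w : Vertex n) → parityᵛ u ≡ parityᵛ w → parity (dist u w) ≡ 0ℙ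
≡parityᵛ⇒even-dist u w eq =
  trans (dist-parity u w) (trans (cong (ℙ._+ parityᵛ w) eq) (p+p≡0ℙ (parityᵛ w)))

parityᵛ-antipode : ∀ {n} → parity n ≡ 0ℙ → (x : Vertex n) → parityᵛ (antipode x) ≡ parityᵛ x
parityᵛ-antipode n-even x =
  sym (even-dist⇒≡parityᵛ x (antipode x) (trans (cong parity (dist-antipode x)) n-even))

module _ {a} {A : Set a} (_≟_ : DecidableEquality A) where

  pigeonhole : ∀ {L M : List A} → Unique L → length M < length L → ∃ λ c → c ∈ L × c ∉ M
  pigeonhole {c ∷ L} {M} (c∉L ∷ L-unique) |M|<|c∷L| with Any.any? (c ≟_) M
  ... | no c∉M = c , here refl , c∉M
  ... | yes c∈M
    with c′ , c′∈L , c′∉M⁻ ← pigeonhole {L} {filter (λ m → ¬? (c ≟ m)) M} L-unique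
           (<-≤-trans (filter-notAll _ M (Any.map (λ c≡m c≢m → c≢m c≡m) c∈M)) (s≤s⁻¹ |M|<|c∷L|))
    = c′ , there c′∈L , λ c′∈M → c′∉M⁻ (∈-filter⁺ _ c′∈M (All.lookup c∉L c′∈L))

withAntipodes : ∀ {n} → List (Vertex n) → List (Vertex n)
withAntipodes []      = []
withAntipodes (x ∷ R) = antipode x ∷ x ∷ withAntipodes R

length-withAntipodes : ∀ {n} (R : List (Vertex n)) → length (withAntipodes R) ≡ length R + length R
length-withAntipodes []      = refl
length-withAntipodes (x ∷ R) =
  cong suc (trans (cong suc (length-withAntipodes R)) (sym (+-suc (length R) (length R))))

antipode-∈-withAntipodes : ∀ {n} {y : Vertex n} R → y ∈ withAntipodes R → antipode y ∈ withAntipodes R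
antipode-∈-withAntipodes (x ∷ R) (here refl)         = there (here (antipode-involutive x))
antipode-∈-withAntipodes (x ∷ R) (there (here refl)) = here refl
antipode-∈-withAntipodes (x ∷ R) (there (there y∈))  = there (there (antipode-∈-withAntipodes R y∈))

All-withAntipodes⁺ : ∀ {n p} {P : Vertex n → Set p} {R} →
                     All (λ x → P (antipode x) × P x) R → All P (withAntipodes R)
All-withAntipodes⁺ []                = []
All-withAntipodes⁺ ((pa , px) ∷ ps) = pa ∷ px ∷ All-withAntipodes⁺ ps

module _ {n N : ℕ} where

  visited-unique : ∀ {u : Vertex n} {S} → Unique S → N ≤ length S → ExplorerForces N u S
  visited-unique {S = S} S-unique N≤|S| = done (S , S-unique , N≤|S| , All.tabulate (λ y∈ → y∈))

  jump-to-antipode : ∀ {u S} → ExplorerForces N (antipode u) (antipode u ∷ S) → ExplorerForces N u S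
  jump-to-antipode {u} {S} forces = round n (dist-surjective u ≤-refl) λ w d≡n →
    subst (λ y → ExplorerForces N y (y ∷ S)) (sym (dist≡n⇒antipode u w d≡n)) forces

  explore-pair : 0 < n → ∀ u {d} R → d ≤ n →
                 All (λ y → dist u y ≢ d) (withAntipodes R) → Unique (withAntipodes R) →
                 (∀ w → dist u w ≡ d → Unique (withAntipodes (w ∷ R)) →
                    ExplorerForces N (antipode w) (withAntipodes (w ∷ R))) →
                 ExplorerForces N u (withAntipodes R)
  explore-pair n>0 u {d} R d≤n free R-unique continue =
    round d (dist-surjective u d≤n) λ w e → jump-to-antipode (continue w e (new-pair w e))
    where
    new-pair : ∀ w → dist u w ≡ d → Unique (withAntipodes (w ∷ R))
    new-pair w e = ¬Any⇒All¬ _ antipode-w∉ ∷ ¬Any⇒All¬ _ w∉ ∷ R-unique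
      where
      w∉ : w ∉ withAntipodes R
      w∉ w∈ = All.lookup free w∈ e
      antipode-w∉ : antipode w ∉ w ∷ withAntipodes R
      antipode-w∉ (here eq) = antipode≢ n>0 w eq
      antipode-w∉ (there a∈) =
        w∉ (subst (_∈ withAntipodes R) (antipode-involutive w) (antipode-∈-withAntipodes R a∈))

module Strategy {n : ℕ} (K : ℕ) (n-even : parity n ≡ 0ℙ) (4K≤n : 4 * K ≤ n) (n>0 : 0 < n) where

  N : ℕ
  N = 4 * K + 4

  OfParity : Parity → Vertex n → Set
  OfParity p y = parityᵛ y ≡ p

  antipode-OfParity : ∀ {p} x → OfParity p x → OfParity p (antipode x)
  antipode-OfParity x = trans (parityᵛ-antipode n-even x)

  even-dist-OfParity : ∀ {p} u w → OfParity p u → parity (dist u w) ≡ 0ℙ → OfParity p w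
  even-dist-OfParity u w u-p even = trans (sym (even-dist⇒≡parityᵛ u w even)) u-p

  OfParity-withAntipodes : ∀ {p R} → All (OfParity p) R → All (OfParity p) (withAntipodes R)
  OfParity-withAntipodes = All-withAntipodes⁺ ∘ All.map (λ {x} x-p → antipode-OfParity x x-p , x-p)

  free-even-distance : ∀ {p} u → OfParity p u → ∀ B O →
                       length B ≤ K → All (λ y → parityᵛ y ≢ p) O →
                       ∃ λ d → parity d ≡ 0ℙ × d ≤ n ×
                               All (λ y → dist u y ≢ d) (withAntipodes (B ++ O))
  free-even-distance {p} u u-p B O |B|≤K O-other
    with c , c∈ , c∉ ← pigeonhole _≟_ {map (2 *_) (upTo (suc K))} {map (pairDist u) B}
           (Unique.map⁺ (λ {i} {j} → *-cancelˡ-≡ i j 2) (Unique.upTo⁺ (suc K)))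
           (subst₂ _<_ (sym (length-map (pairDist u) B))
                       (sym (trans (length-map (2 *_) (upTo (suc K))) (length-upTo (suc K)))) (s≤s |B|≤K))
    with i , i∈ , refl ← ∈-map⁻ (2 *_) {xs = upTo (suc K)} c∈
    = 2 * i , *-homo-* 2 i , ≤-trans (m≤m+n (2 * i) (2 * i)) c+c≤n
    , All-withAntipodes⁺ (++⁺ (All.tabulate avoid-same) (All.map avoid-other O-other))
    where
    c+c≤n : 2 * i + 2 * i ≤ n
    c+c≤n = ≤-trans (≤-reflexive (sym (*-distribʳ-+ i 2 2)))
                    (≤-trans (*-monoʳ-≤ 4 (s≤s⁻¹ (∈-upTo⁻ i∈))) 4K≤n)
    avoid-same : ∀ {y} → y ∈ B → dist u (antipode y) ≢ 2 * i × dist u y ≢ 2 * i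
    avoid-same {y} y∈ = blocked ∘ inj₂ , blocked ∘ inj₁
      where
      blocked : dist u y ≡ 2 * i ⊎ dist u (antipode y) ≡ 2 * i → ⊥
      blocked e = c∉ (subst (_∈ map (pairDist u) B) (pairDist≡ u y c+c≤n e) (∈-map⁺ (pairDist u) y∈))
    avoid-second-phase : ∀ y → parityᵛ y ≢ p → dist u y ≢ 2 * i
    avoid-second-phase y y-other e = y-other (even-dist-OfParity u y u-p (trans (cong parity e) (*-homo-* 2 i)))
    avoid-other : ∀ {y} → parityᵛ y ≢ p → dist u (antipode y) ≢ 2 * i × dist u y ≢ 2 * i
    avoid-other {y} y-other =
        avoid-second-phase (antipode y) (λ eq → y-other (trans (sym (parityᵛ-antipode n-even y)) eq))
      , avoid-second-phase y y-other

  Winning : Vertex n → List (Vertex n) → Set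
  Winning x R = ExplorerForces N (antipode x) (withAntipodes (x ∷ R))

  collect : ∀ {p} O j {x S} → OfParity p x → All (OfParity p) S → All (λ y → parityᵛ y ≢ p) O →
            length (x ∷ S) + j ≡ suc K → Unique (withAntipodes (x ∷ S ++ O)) →
            (∀ {x S} → OfParity p x → All (OfParity p) S → length (x ∷ S) ≡ suc K →
               Unique (withAntipodes (x ∷ S ++ O)) → Winning x (S ++ O)) →
            Winning x (S ++ O)
  collect O zero    x-p S-p O-other length≡ unique finish =
    finish x-p S-p (trans (sym (+-identityʳ _)) length≡) unique
  collect O (suc j) {x} {S} x-p S-p O-other length≡ unique finish
    with d , d-even , d≤n , free ← free-even-distance (antipode x) (antipode-OfParity x x-p) (x ∷ S) O
           (m+n≤o⇒m≤o (length (x ∷ S)) (≤-reflexive (suc-injective (trans (sym (+-suc _ j)) length≡))))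
           O-other
    = explore-pair n>0 (antipode x) (x ∷ S ++ O) d≤n free unique λ w e unique′ →
        collect O j (even-dist-OfParity (antipode x) w (antipode-OfParity x x-p) (trans (cong parity e) d-even))
          (x-p ∷ S-p) O-other (trans (sym (+-suc _ j)) length≡) unique′ finish

  switch-parity : ∀ {p} x S → OfParity p x → All (OfParity p) S → Unique (withAntipodes (x ∷ S)) →
                  (∀ w → parityᵛ w ≢ p → Unique (withAntipodes (w ∷ x ∷ S)) → Winning w (x ∷ S)) →
                  Winning x S
  switch-parity x S x-p S-p unique continue =
    explore-pair n>0 (antipode x) (x ∷ S) n>0 (All.map not-at-1 (OfParity-withAntipodes (x-p ∷ S-p))) unique
      λ w e → continue w (λ w-p → not-at-1 w-p e)
    where
    not-at-1 : ∀ {y} → OfParity _ y → dist (antipode x) y ≢ 1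
    not-at-1 {y} y-p e = ℙ.p≢p⁻¹ 0ℙ (trans (sym even) (cong parity e))
      where
      even : parity (dist (antipode x) y) ≡ 0ℙ
      even = ≡parityᵛ⇒even-dist (antipode x) y (trans (antipode-OfParity x x-p) (sym y-p))

  enough-pairs : ∀ (R₁ R₂ : List (Vertex n)) → length R₁ ≡ suc K → length R₂ ≡ suc K →
                 N ≤ length (withAntipodes (R₁ ++ R₂))
  enough-pairs R₁ R₂ ℓ₁ ℓ₂ = ≤-reflexive (begin
    4 * K + 4                               ≡⟨ four-pairs K ⟩
    (suc K + suc K) + (suc K + suc K)       ≡⟨ cong (λ m → m + m) (sym length-R₁++R₂) ⟩
    length (R₁ ++ R₂) + length (R₁ ++ R₂)   ≡⟨ sym (length-withAntipodes (R₁ ++ R₂)) ⟩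
    length (withAntipodes (R₁ ++ R₂))       ∎)
    where
    open ≡-Reasoning
    length-R₁++R₂ : length (R₁ ++ R₂) ≡ suc K + suc K
    length-R₁++R₂ = trans (length-++ R₁) (cong₂ _+_ ℓ₁ ℓ₂)
    four-pairs : ∀ m → 4 * m + 4 ≡ (suc m + suc m) + (suc m + suc m)
    four-pairs = solve-∀

  explorer-forces : (v : Vertex n) → fd-Q-≥ n v N
  explorer-forces v =
    jump-to-antipode (collect [] K refl [] [] refl ((antipode≢ n>0 v ∷ []) ∷ [] ∷ []) second-phase)
    where
    second-phase : ∀ {x S} → OfParity (parityᵛ v) x → All (OfParity (parityᵛ v)) S →
                  length (x ∷ S) ≡ suc K →
                  Unique (withAntipodes (x ∷ S ++ [])) → Winning x (S ++ [])
    second-phase {x} {S} x-p S-p length≡ unique =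
      switch-parity x (S ++ []) x-p (++⁺ S-p []) unique λ w w-other unique′ →
        collect (x ∷ S ++ []) K refl [] (All.map (λ y-p eq → w-other (trans (sym eq) y-p)) (x-p ∷ ++⁺ S-p []))
          refl unique′ λ {x′} {S′} _ _ length≡′ unique″ →
            visited-unique unique″ (enough-pairs (x′ ∷ S′) (x ∷ S ++ []) length≡′ length-x∷S++[])
      where
      length-x∷S++[] : length (x ∷ S ++ []) ≡ suc K
      length-x∷S++[] = trans (cong length (++-identityʳ (x ∷ S))) length≡

lemma4p6 : (k : ℕ) → (v : Vertex (4 * suc k)) → fd-Q-≥ (4 * suc k) v (4 * suc k + 4)
lemma4p6 k = Strategy.explorer-forces (suc k) (*-homo-* 4 (suc k)) ≤-refl (s≤s z≤n)
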